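{- For any integers $n\ge k\ge 1$, $$w(n,k)=\sum_{j=1}^k\binom{n-j}{k-j}N(n,j)\qquad\text{and}\qquad N(n,k)=\sum_{j=1}^k\binom{n-j}{k-j}(-1)^{k-j}w(n,j).$$
   Context: For integers $n\ge k\ge1$, $N(n,k)=\frac1n\binom{n}{k}\binom{n}{k-1}$ (Narayana number) and $w(n,k)=\frac1k\binom{n-1}{k-1}\binom{n+k}{k-1}$. -}

module Defs where

open import Data.Nat using (ℕ; zero; suc; _∸_)
import Data.Nat as ℕ
open import Data.Nat.Combinatorics using (_C_)
open import Data.Integer using (+_)
open import Data.Rational using (ℚ; _/_; _+_; _*_; -_; 0ℚ; 1ℚ)

ι : ℕ → ℚ
ι m = + m / 1

-- Narayana number N(n,k) = (1/n) C(n,k) C(n,k-1), as a rational.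
-- (n = 0 never occurs under the hypotheses n ≥ k ≥ 1; we set it to 0 there.)
Nar : ℕ → ℕ → ℚ
Nar zero      k = 0ℚ
Nar (suc m) k = + ((suc m C k) ℕ.* (suc m C (k ∸ 1))) / suc m

-- w(n,k) = (1/k) C(n-1,k-1) C(n+k,k-1), as a rational.
-- (k = 0 never occurs under the hypotheses; we set it to 0 there.)
w : ℕ → ℕ → ℚ
w n zero      = 0ℚ
w n (suc m) = + (((n ∸ 1) C m) ℕ.* ((n ℕ.+ suc m) C m)) / suc m

sgn : ℕ → ℚ
sgn zero    = 1ℚ
sgn (suc e) = - sgn e

sum1 : ℕ → (ℕ → ℚ) → ℚ
sum1 zero    f = 0ℚ
sum1 (suc k) f = sum1 k f + f (suc k)

module Submission where

-- Write n = m+1.  Absorption and the "subset of a subset" identity give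
--   C(n−j,k−j)·N(n,j) = (1/n)·C(n,k)·C(k,j)·C(n,j−1),
--   C(n−j,k−j)·w(n,j) = (1/n)·C(n,k)·C(k,j)·C(n+j,j−1),
-- so, after pulling out (1/n)·C(n,k), both claims become classical binomial identities:
--   Σⱼ C(k,j)·C(n,j−1) = C(n+k,k−1)                  (Vandermonde),
--   Σⱼ (−1)^{k−j}·C(k,j)·C(n+j,j−1) = C(n,k−1)        (a k-th finite difference).
-- Both are instances of one general fact, the binomial theorem for the operator E + c
-- (E the shift x ↦ x+1): if a family gᵢ satisfies g_{i+1}(x) = gᵢ(x+1) + c·gᵢ(x), then
--   Σⱼ C(k,j)·c^{k−j}·g₀(j) = g_k(0);
-- for c = 1 and c = −1 the families are binomial coefficients with a shifted lower
-- index, for which the recursion is Pascal's rule.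

open import Defs
open import Data.Nat as ℕ using (ℕ; zero; suc; _∸_; _≤_; z≤n; s≤s; _!)
import Data.Nat.Properties as ℕ
open import Data.Nat.Combinatorics using (_C_; k>n⇒nCk≡0; nCk+nC[k+1]≡[n+1]C[k+1]; nCk≡n!/k![n-k]!; k![n∸k]!∣n!)
open import Data.Nat.DivMod using (m/n*n≡m)
open import Data.Nat.Tactic.RingSolver as ℕ-Solver using ()
import Data.Integer as ℤ
import Data.Integer.Properties as ℤ
open import Data.Integer.Tactic.RingSolver as ℤ-Solver using ()
open import Data.Rational using (ℚ; _/_; toℚᵘ; _+_; _*_; -_; 0ℚ; 1ℚ; +-*-rawSemiring)
open import Data.Rational.Properties
  using (toℚᵘ-injective; toℚᵘ-fromℚᵘ; toℚᵘ-homo-+; toℚᵘ-homo-*; +-assoc; +-identityˡ; +-identityʳ; *-identityˡ; *-zeroˡ; *-zeroʳ; *-distribˡ-+; *-distribʳ-+; +-0-commutativeMonoid)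
open import Data.Rational.Solver using (module +-*-Solver)
open import Data.Rational.Unnormalised as ℚᵘ using (mkℚᵘ; *≡*)
import Data.Rational.Unnormalised.Properties as ℚᵘ
open import Algebra.Bundles using (CommutativeMonoid)
open import Algebra.Properties.CommutativeSemigroup (CommutativeMonoid.commutativeSemigroup +-0-commutativeMonoid) using (interchange)
open import Algebra.Definitions.RawSemiring +-*-rawSemiring using (_^_)
open import Data.Product using (_×_; _,_)
open import Function using (_∘_)
open import Relation.Nullary using (yes; no)
open import Relation.Binary.PropositionalEquality
open +-*-Solver using (solve; _:=_; _:+_; _:*_; :-_; con)

toℚᵘ-/ : ∀ i d → toℚᵘ (i / suc d) ℚᵘ.≃ mkℚᵘ i d
toℚᵘ-/ i d = toℚᵘ-fromℚᵘ (mkℚᵘ i d)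

ι-+ : ∀ a b → ι (a ℕ.+ b) ≡ ι a + ι b
ι-+ a b = toℚᵘ-injective (begin
  toℚᵘ (ι (a ℕ.+ b))              ≈⟨ toℚᵘ-/ (ℤ.+ (a ℕ.+ b)) 0 ⟩
  mkℚᵘ (ℤ.+ (a ℕ.+ b)) 0            ≈⟨ *≡* (trans (cong (ℤ._* ℤ.+ 1) (ℤ.pos-+ a b)) (cross (ℤ.+ a) (ℤ.+ b))) ⟩
  mkℚᵘ (ℤ.+ a) 0 ℚᵘ.+ mkℚᵘ (ℤ.+ b) 0  ≈⟨ ℚᵘ.+-cong (toℚᵘ-/ (ℤ.+ a) 0) (toℚᵘ-/ (ℤ.+ b) 0) ⟨
  toℚᵘ (ι a) ℚᵘ.+ toℚᵘ (ι b)      ≈⟨ toℚᵘ-homo-+ (ι a) (ι b) ⟨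
  toℚᵘ (ι a + ι b)                ∎)
  where
  open ℚᵘ.≃-Reasoning
  cross : ∀ i j → (i ℤ.+ j) ℤ.* (ℤ.+ 1 ℤ.* ℤ.+ 1) ≡ (i ℤ.* ℤ.+ 1 ℤ.+ j ℤ.* ℤ.+ 1) ℤ.* ℤ.+ 1
  cross = ℤ-Solver.solve-∀

ι-* : ∀ a b → ι (a ℕ.* b) ≡ ι a * ι b
ι-* a b = toℚᵘ-injective (begin
  toℚᵘ (ι (a ℕ.* b))              ≈⟨ toℚᵘ-/ (ℤ.+ (a ℕ.* b)) 0 ⟩
  mkℚᵘ (ℤ.+ (a ℕ.* b)) 0            ≈⟨ *≡* (trans (cong (ℤ._* ℤ.+ 1) (ℤ.pos-* a b)) (cross (ℤ.+ a) (ℤ.+ b))) ⟩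
  mkℚᵘ (ℤ.+ a) 0 ℚᵘ.* mkℚᵘ (ℤ.+ b) 0  ≈⟨ ℚᵘ.*-cong (toℚᵘ-/ (ℤ.+ a) 0) (toℚᵘ-/ (ℤ.+ b) 0) ⟨
  toℚᵘ (ι a) ℚᵘ.* toℚᵘ (ι b)      ≈⟨ toℚᵘ-homo-* (ι a) (ι b) ⟨
  toℚᵘ (ι a * ι b)                ∎)
  where
  open ℚᵘ.≃-Reasoning
  cross : ∀ i j → (i ℤ.* j) ℤ.* (ℤ.+ 1 ℤ.* ℤ.+ 1) ≡ (i ℤ.* j) ℤ.* ℤ.+ 1
  cross = ℤ-Solver.solve-∀

inv : ℕ → ℚ
inv d = ℤ.+ 1 / suc d

frac : ∀ a d → ℤ.+ a / suc d ≡ ι a * inv d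
frac a d = toℚᵘ-injective (begin
  toℚᵘ (ℤ.+ a / suc d)               ≈⟨ toℚᵘ-/ (ℤ.+ a) d ⟩
  mkℚᵘ (ℤ.+ a) d                     ≈⟨ *≡* (cross (ℤ.+ a) (ℤ.+ suc d)) ⟩
  mkℚᵘ (ℤ.+ a) 0 ℚᵘ.* mkℚᵘ (ℤ.+ 1) d   ≈⟨ ℚᵘ.*-cong (toℚᵘ-/ (ℤ.+ a) 0) (toℚᵘ-/ (ℤ.+ 1) d) ⟨
  toℚᵘ (ι a) ℚᵘ.* toℚᵘ (inv d)     ≈⟨ toℚᵘ-homo-* (ι a) (inv d) ⟨
  toℚᵘ (ι a * inv d)               ∎)
  where
  open ℚᵘ.≃-Reasoning
  cross : ∀ x y → x ℤ.* (ℤ.+ 1 ℤ.* y) ≡ (x ℤ.* ℤ.+ 1) ℤ.* y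
  cross = ℤ-Solver.solve-∀

frac-cross : ∀ a b d e → a ℕ.* suc e ≡ b ℕ.* suc d → ℤ.+ a / suc d ≡ ℤ.+ b / suc e
frac-cross a b d e eq = toℚᵘ-injective (begin
  toℚᵘ (ℤ.+ a / suc d)  ≈⟨ toℚᵘ-/ (ℤ.+ a) d ⟩
  mkℚᵘ (ℤ.+ a) d        ≈⟨ *≡* (trans (sym (ℤ.pos-* a (suc e))) (trans (cong ℤ.+_ eq) (ℤ.pos-* b (suc d)))) ⟩
  mkℚᵘ (ℤ.+ b) e        ≈⟨ toℚᵘ-/ (ℤ.+ b) e ⟨
  toℚᵘ (ℤ.+ b / suc e)  ∎)
  where open ℚᵘ.≃-Reasoning

open ≡-Reasoning

Σ₀ : ℕ → (ℕ → ℚ) → ℚ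
Σ₀ k f = f 0 + sum1 k f

sum1-cong : ∀ k {f g : ℕ → ℚ} → (∀ j → 1 ≤ j → j ≤ k → f j ≡ g j) → sum1 k f ≡ sum1 k g
sum1-cong zero    f≡g = refl
sum1-cong (suc k) f≡g =
  cong₂ _+_ (sum1-cong k (λ j 1≤j j≤k → f≡g j 1≤j (ℕ.m≤n⇒m≤1+n j≤k))) (f≡g (suc k) (s≤s z≤n) ℕ.≤-refl)

Σ₀-cong : ∀ k {f g : ℕ → ℚ} → (∀ j → j ≤ k → f j ≡ g j) → Σ₀ k f ≡ Σ₀ k g
Σ₀-cong k f≡g = cong₂ _+_ (f≡g 0 z≤n) (sum1-cong k (λ j _ j≤k → f≡g j j≤k))

sum1-+ : ∀ k (f g : ℕ → ℚ) → sum1 k (λ j → f j + g j) ≡ sum1 k f + sum1 k g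
sum1-+ zero    f g = refl
sum1-+ (suc k) f g = begin
  sum1 k (λ j → f j + g j) + (f (suc k) + g (suc k))  ≡⟨ cong (_+ (f (suc k) + g (suc k))) (sum1-+ k f g) ⟩
  (sum1 k f + sum1 k g) + (f (suc k) + g (suc k))     ≡⟨ interchange (sum1 k f) (sum1 k g) (f (suc k)) (g (suc k)) ⟩
  (sum1 k f + f (suc k)) + (sum1 k g + g (suc k))     ∎

Σ₀-+ : ∀ k (f g : ℕ → ℚ) → Σ₀ k (λ j → f j + g j) ≡ Σ₀ k f + Σ₀ k g
Σ₀-+ k f g = begin
  (f 0 + g 0) + sum1 k (λ j → f j + g j)  ≡⟨ cong ((f 0 + g 0) +_) (sum1-+ k f g) ⟩
  (f 0 + g 0) + (sum1 k f + sum1 k g)     ≡⟨ interchange (f 0) (g 0) (sum1 k f) (sum1 k g) ⟩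
  (f 0 + sum1 k f) + (g 0 + sum1 k g)     ∎

sum1-*ˡ : ∀ k c (f : ℕ → ℚ) → sum1 k (λ j → c * f j) ≡ c * sum1 k f
sum1-*ˡ zero    c f = sym (*-zeroʳ c)
sum1-*ˡ (suc k) c f = begin
  sum1 k (λ j → c * f j) + c * f (suc k)  ≡⟨ cong (_+ c * f (suc k)) (sum1-*ˡ k c f) ⟩
  c * sum1 k f + c * f (suc k)            ≡⟨ *-distribˡ-+ c (sum1 k f) (f (suc k)) ⟨
  c * (sum1 k f + f (suc k))              ∎

Σ₀-*ˡ : ∀ k c (f : ℕ → ℚ) → Σ₀ k (λ j → c * f j) ≡ c * Σ₀ k f
Σ₀-*ˡ k c f = begin
  c * f 0 + sum1 k (λ j → c * f j)  ≡⟨ cong (c * f 0 +_) (sum1-*ˡ k c f) ⟩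
  c * f 0 + c * sum1 k f            ≡⟨ *-distribˡ-+ c (f 0) (sum1 k f) ⟨
  c * (f 0 + sum1 k f)              ∎

sum1-shift : ∀ k (f : ℕ → ℚ) → sum1 (suc k) f ≡ Σ₀ k (f ∘ suc)
sum1-shift zero    f = trans (+-identityˡ (f 1)) (sym (+-identityʳ (f 1)))
sum1-shift (suc k) f = begin
  sum1 (suc k) f + f (suc (suc k))                ≡⟨ cong (_+ f (suc (suc k))) (sum1-shift k f) ⟩
  (f 1 + sum1 k (f ∘ suc)) + f (suc (suc k))      ≡⟨ +-assoc (f 1) (sum1 k (f ∘ suc)) (f (suc (suc k))) ⟩
  f 1 + (sum1 k (f ∘ suc) + f (suc (suc k)))      ∎

sum1≡Σ₀ : ∀ k (f : ℕ → ℚ) → f 0 ≡ 0ℚ → sum1 k f ≡ Σ₀ k f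
sum1≡Σ₀ k f f0≡0 = sym (trans (cong (_+ sum1 k f) f0≡0) (+-identityˡ (sum1 k f)))

-- Cpred n t = C(n, t−1), with the convention C(n, −1) = 0.
Cpred : ℕ → ℕ → ℕ
Cpred n zero    = 0
Cpred n (suc t) = n C t

-- Pascal's rule holds for the shifted coefficients without any side condition.
Cpred-pascal : ∀ n t → Cpred (suc n) (suc t) ≡ Cpred n t ℕ.+ Cpred n (suc t)
Cpred-pascal n zero    = refl
Cpred-pascal n (suc t) = sym (nCk+nC[k+1]≡[n+1]C[k+1] n t)

ι-Cpred-pascal : ∀ n t → ι (Cpred (suc n) (suc t)) ≡ ι (Cpred n t) + ι (Cpred n (suc t))
ι-Cpred-pascal n t = trans (cong ι (Cpred-pascal n t)) (ι-+ (Cpred n t) (Cpred n (suc t)))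

C-factorial : ∀ {n k} → k ≤ n → (n C k) ℕ.* (k ! ℕ.* (n ∸ k) !) ≡ n !
C-factorial {n} {k} k≤n =
  trans (cong (ℕ._* (k ! ℕ.* (n ∸ k) !)) (nCk≡n!/k![n-k]! k≤n))
        (m/n*n≡m {{k ℕ.!* (n ∸ k) !≢0}} (k![n∸k]!∣n! k≤n))

absorption : ∀ m l → suc l ℕ.* (suc m C suc l) ≡ suc m ℕ.* (m C l)
absorption m l with l ℕ.≤? m
... | no l≰m = begin
  suc l ℕ.* (suc m C suc l)  ≡⟨ cong (suc l ℕ.*_) (k>n⇒nCk≡0 (ℕ.s<s (ℕ.≰⇒> l≰m))) ⟩
  suc l ℕ.* 0                ≡⟨ ℕ.*-zeroʳ (suc l) ⟩
  0                          ≡⟨ ℕ.*-zeroʳ (suc m) ⟨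
  suc m ℕ.* 0                ≡⟨ cong (suc m ℕ.*_) (k>n⇒nCk≡0 (ℕ.≰⇒> l≰m)) ⟨
  suc m ℕ.* (m C l)          ∎
... | yes l≤m = ℕ.*-cancelʳ-≡ _ _ (l ! ℕ.* (m ∸ l) !) {{l ℕ.!* (m ∸ l) !≢0}} (begin
  suc l ℕ.* (suc m C suc l) ℕ.* (l ! ℕ.* (m ∸ l) !)  ≡⟨ regroup₁ (suc l) (suc m C suc l) (l !) ((m ∸ l) !) ⟩
  (suc m C suc l) ℕ.* (suc l ! ℕ.* (m ∸ l) !)        ≡⟨ C-factorial (s≤s l≤m) ⟩
  suc m ℕ.* m !                                      ≡⟨ cong (suc m ℕ.*_) (C-factorial l≤m) ⟨
  suc m ℕ.* ((m C l) ℕ.* (l ! ℕ.* (m ∸ l) !))        ≡⟨ regroup₂ (suc m) (m C l) (l !) ((m ∸ l) !) ⟩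
  suc m ℕ.* (m C l) ℕ.* (l ! ℕ.* (m ∸ l) !)          ∎)
  where
  regroup₁ : ∀ a b x y → a ℕ.* b ℕ.* (x ℕ.* y) ≡ b ℕ.* (a ℕ.* x ℕ.* y)
  regroup₁ = ℕ-Solver.solve-∀
  regroup₂ : ∀ a b x y → a ℕ.* (b ℕ.* (x ℕ.* y)) ≡ a ℕ.* b ℕ.* (x ℕ.* y)
  regroup₂ = ℕ-Solver.solve-∀

C-factorial-shifted : ∀ {n k j} → j ≤ k → k ≤ n → ((n ∸ j) C (k ∸ j)) ℕ.* ((k ∸ j) ! ℕ.* (n ∸ k) !) ≡ (n ∸ j) !
C-factorial-shifted {n} {k} {j} j≤k k≤n =
  subst (λ r → ((n ∸ j) C (k ∸ j)) ℕ.* ((k ∸ j) ! ℕ.* r !) ≡ (n ∸ j) !) complement (C-factorial (ℕ.∸-monoˡ-≤ j k≤n))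
  where
  complement : (n ∸ j) ∸ (k ∸ j) ≡ n ∸ k
  complement = trans (ℕ.∸-+-assoc n j (k ∸ j)) (cong (n ∸_) (ℕ.m+[n∸m]≡n j≤k))

-- Subset of a subset: C(n−j,k−j)·C(n,j) = C(n,k)·C(k,j) for j ≤ k ≤ n; both sides
-- equal n!/(j!(k−j)!(n−k)!).
subset-of-subset : ∀ {n k j} → j ≤ k → k ≤ n → ((n ∸ j) C (k ∸ j)) ℕ.* (n C j) ≡ (n C k) ℕ.* (k C j)
subset-of-subset {n} {k} {j} j≤k k≤n =
  ℕ.*-cancelʳ-≡ _ _ (j ! ℕ.* (k ∸ j) ! ℕ.* (n ∸ k) !) {{nonZero}} (trans left (sym right))
  where
  nonZero : ℕ.NonZero (j ! ℕ.* (k ∸ j) ! ℕ.* (n ∸ k) !)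
  nonZero = ℕ.m*n≢0 (j ! ℕ.* (k ∸ j) !) ((n ∸ k) !) {{j ℕ.!* (k ∸ j) !≢0}} {{(n ∸ k) ℕ.!≢0}}
  regroup₁ : ∀ a b x y z → a ℕ.* b ℕ.* (x ℕ.* y ℕ.* z) ≡ b ℕ.* (x ℕ.* (a ℕ.* (y ℕ.* z)))
  regroup₁ = ℕ-Solver.solve-∀
  regroup₂ : ∀ a b x y z → a ℕ.* b ℕ.* (x ℕ.* y ℕ.* z) ≡ a ℕ.* (z ℕ.* (b ℕ.* (x ℕ.* y)))
  regroup₂ = ℕ-Solver.solve-∀
  left : ((n ∸ j) C (k ∸ j)) ℕ.* (n C j) ℕ.* (j ! ℕ.* (k ∸ j) ! ℕ.* (n ∸ k) !) ≡ n !
  left = begin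
    ((n ∸ j) C (k ∸ j)) ℕ.* (n C j) ℕ.* (j ! ℕ.* (k ∸ j) ! ℕ.* (n ∸ k) !)
      ≡⟨ regroup₁ ((n ∸ j) C (k ∸ j)) (n C j) (j !) ((k ∸ j) !) ((n ∸ k) !) ⟩
    (n C j) ℕ.* (j ! ℕ.* (((n ∸ j) C (k ∸ j)) ℕ.* ((k ∸ j) ! ℕ.* (n ∸ k) !)))
      ≡⟨ cong (λ t → (n C j) ℕ.* (j ! ℕ.* t)) (C-factorial-shifted j≤k k≤n) ⟩
    (n C j) ℕ.* (j ! ℕ.* (n ∸ j) !)
      ≡⟨ C-factorial (ℕ.≤-trans j≤k k≤n) ⟩
    n ! ∎
  right : (n C k) ℕ.* (k C j) ℕ.* (j ! ℕ.* (k ∸ j) ! ℕ.* (n ∸ k) !) ≡ n !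
  right = begin
    (n C k) ℕ.* (k C j) ℕ.* (j ! ℕ.* (k ∸ j) ! ℕ.* (n ∸ k) !)
      ≡⟨ regroup₂ (n C k) (k C j) (j !) ((k ∸ j) !) ((n ∸ k) !) ⟩
    (n C k) ℕ.* ((n ∸ k) ! ℕ.* ((k C j) ℕ.* (j ! ℕ.* (k ∸ j) !)))
      ≡⟨ cong (λ t → (n C k) ℕ.* ((n ∸ k) ! ℕ.* t)) (C-factorial j≤k) ⟩
    (n C k) ℕ.* ((n ∸ k) ! ℕ.* k !)
      ≡⟨ cong ((n C k) ℕ.*_) (ℕ.*-comm ((n ∸ k) !) (k !)) ⟩
    (n C k) ℕ.* (k ! ℕ.* (n ∸ k) !)
      ≡⟨ C-factorial k≤n ⟩
    n ! ∎

pascal-split : ∀ k (h : ℕ → ℚ) →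
  Σ₀ (suc k) (λ j → ι (suc k C j) * h j)
    ≡ Σ₀ k (λ j → ι (k C j) * h (suc j)) + Σ₀ k (λ j → ι (k C j) * h j)
pascal-split k h = begin
  Σ₀ (suc k) F                                    ≡⟨ cong (F 0 +_) (sum1-shift k F) ⟩
  F 0 + Σ₀ k (F ∘ suc)                            ≡⟨ cong (F 0 +_) (Σ₀-cong k (λ i _ → split i)) ⟩
  F 0 + Σ₀ k (λ i → A i + B (suc i))              ≡⟨ cong (F 0 +_) (Σ₀-+ k A (B ∘ suc)) ⟩
  F 0 + (Σ₀ k A + Σ₀ k (B ∘ suc))                 ≡⟨ cong (λ t → F 0 + (Σ₀ k A + t)) (sum1-shift k B) ⟨
  F 0 + (Σ₀ k A + (sum1 k B + B (suc k)))         ≡⟨ cong (λ t → F 0 + (Σ₀ k A + (sum1 k B + t))) top ⟩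
  F 0 + (Σ₀ k A + (sum1 k B + 0ℚ))                ≡⟨ solve 3 (λ b₀ a b → b₀ :+ (a :+ (b :+ con 0ℚ)) := a :+ (b₀ :+ b)) refl (B 0) (Σ₀ k A) (sum1 k B) ⟩
  Σ₀ k A + Σ₀ k B                                 ∎
  where
  F A B : ℕ → ℚ
  F j = ι (suc k C j) * h j
  A j = ι (k C j) * h (suc j)
  B j = ι (k C j) * h j
  split : ∀ i → F (suc i) ≡ A i + B (suc i)
  split i = trans (cong (_* h (suc i)) (ι-Cpred-pascal k (suc i))) (*-distribʳ-+ (h (suc i)) (ι (k C i)) (ι (k C suc i)))
  top : B (suc k) ≡ 0ℚ
  top = trans (cong (λ t → ι t * h (suc k)) (k>n⇒nCk≡0 (ℕ.n<1+n k))) (*-zeroˡ (h (suc k)))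

-- The induction step applies the hypothesis to the shifted family x ↦ gᵢ(x+1).
binomial-transform : (c : ℚ) (g : ℕ → ℕ → ℚ) → (∀ i x → g (suc i) x ≡ g i (suc x) + c * g i x) →
  ∀ k → Σ₀ k (λ j → ι (k C j) * (c ^ (k ∸ j) * g 0 j)) ≡ g k 0
binomial-transform c g step zero = solve 1 (λ x → con 1ℚ :* (con 1ℚ :* x) :+ con 0ℚ := x) refl (g 0 0)
binomial-transform c g step (suc k) = begin
  Σ₀ (suc k) (λ j → ι (suc k C j) * (c ^ (suc k ∸ j) * g 0 j))
    ≡⟨ pascal-split k (λ j → c ^ (suc k ∸ j) * g 0 j) ⟩
  Σ₀ k (λ j → ι (k C j) * (c ^ (k ∸ j) * g 0 (suc j))) + Σ₀ k (λ j → ι (k C j) * (c ^ (suc k ∸ j) * g 0 j))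
    ≡⟨ cong₂ _+_ (binomial-transform c (λ i x → g i (suc x)) (λ i x → step i (suc x)) k) lower ⟩
  g k 1 + c * g k 0
    ≡⟨ step k 0 ⟨
  g (suc k) 0 ∎
  where
  pull-c : ∀ j → j ≤ k → ι (k C j) * (c ^ (suc k ∸ j) * g 0 j) ≡ c * (ι (k C j) * (c ^ (k ∸ j) * g 0 j))
  pull-c j j≤k rewrite ℕ.+-∸-assoc 1 j≤k =
    solve 4 (λ b c p x → b :* ((c :* p) :* x) := c :* (b :* (p :* x))) refl (ι (k C j)) c (c ^ (k ∸ j)) (g 0 j)
  lower : Σ₀ k (λ j → ι (k C j) * (c ^ (suc k ∸ j) * g 0 j)) ≡ c * g k 0
  lower = begin
    Σ₀ k (λ j → ι (k C j) * (c ^ (suc k ∸ j) * g 0 j))      ≡⟨ Σ₀-cong k pull-c ⟩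
    Σ₀ k (λ j → c * (ι (k C j) * (c ^ (k ∸ j) * g 0 j)))    ≡⟨ Σ₀-*ˡ k c _ ⟩
    c * Σ₀ k (λ j → ι (k C j) * (c ^ (k ∸ j) * g 0 j))      ≡⟨ cong (c *_) (binomial-transform c g step k) ⟩
    c * g k 0                                                ∎

1^e≡1 : ∀ e → 1ℚ ^ e ≡ 1ℚ
1^e≡1 zero    = refl
1^e≡1 (suc e) = trans (*-identityˡ (1ℚ ^ e)) (1^e≡1 e)

sgn≡[-1]^ : ∀ e → sgn e ≡ (- 1ℚ) ^ e
sgn≡[-1]^ zero    = refl
sgn≡[-1]^ (suc e) = trans (cong -_ (sgn≡[-1]^ e)) (solve 1 (λ x → :- x := (:- con 1ℚ) :* x) refl ((- 1ℚ) ^ e))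

-- Vandermonde: Σ_{j=0}^{k} C(k,j)·C(n,j−1) = C(n+k,k−1).
-- Take c = 1 and gᵢ(x) = C(i+n, i+x−1), whose recursion is Pascal's rule.
vandermonde : ∀ n k → Σ₀ k (λ j → ι (k C j) * ι (Cpred n j)) ≡ ι (Cpred (k ℕ.+ n) k)
vandermonde n k = begin
  Σ₀ k (λ j → ι (k C j) * ι (Cpred n j))                     ≡⟨ Σ₀-cong k (λ j _ → cong (ι (k C j) *_) (unit (k ∸ j) (ι (Cpred n j)))) ⟨
  Σ₀ k (λ j → ι (k C j) * (1ℚ ^ (k ∸ j) * ι (Cpred n j)))    ≡⟨ binomial-transform 1ℚ g step k ⟩
  ι (Cpred (k ℕ.+ n) (k ℕ.+ 0))                              ≡⟨ cong (ι ∘ Cpred (k ℕ.+ n)) (ℕ.+-identityʳ k) ⟩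
  ι (Cpred (k ℕ.+ n) k)                                      ∎
  where
  unit : ∀ e x → 1ℚ ^ e * x ≡ x
  unit e x = trans (cong (_* x) (1^e≡1 e)) (*-identityˡ x)
  g : ℕ → ℕ → ℚ
  g i x = ι (Cpred (i ℕ.+ n) (i ℕ.+ x))
  step : ∀ i x → g (suc i) x ≡ g i (suc x) + 1ℚ * g i x
  step i x rewrite ℕ.+-suc i x =
    trans (ι-Cpred-pascal (i ℕ.+ n) (i ℕ.+ x))
          (solve 2 (λ a b → a :+ b := b :+ con 1ℚ :* a) refl (g i x) (ι (Cpred (i ℕ.+ n) (suc (i ℕ.+ x)))))

-- The k-th finite difference: Σ_{j=0}^{k} (−1)^{k−j}·C(k,j)·C(n+j,j−1) = C(n,k−1).
-- Take c = −1 and gᵢ(x) = C(x+n, i+x−1), whose recursion is again Pascal's rule.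
alternating : ∀ n k → Σ₀ k (λ j → ι (k C j) * (sgn (k ∸ j) * ι (Cpred (j ℕ.+ n) j))) ≡ ι (Cpred n k)
alternating n k = begin
  Σ₀ k (λ j → ι (k C j) * (sgn (k ∸ j) * ι (Cpred (j ℕ.+ n) j)))          ≡⟨ Σ₀-cong k (λ j _ → cong (λ s → ι (k C j) * (s * g 0 j)) (sgn≡[-1]^ (k ∸ j))) ⟩
  Σ₀ k (λ j → ι (k C j) * ((- 1ℚ) ^ (k ∸ j) * ι (Cpred (j ℕ.+ n) j)))     ≡⟨ binomial-transform (- 1ℚ) g step k ⟩
  ι (Cpred n (k ℕ.+ 0))                                                   ≡⟨ cong (ι ∘ Cpred n) (ℕ.+-identityʳ k) ⟩
  ι (Cpred n k)                                                           ∎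
  where
  g : ℕ → ℕ → ℚ
  g i x = ι (Cpred (x ℕ.+ n) (i ℕ.+ x))
  step : ∀ i x → g (suc i) x ≡ g i (suc x) + (- 1ℚ) * g i x
  step i x rewrite ℕ.+-suc i x =
    sym (trans (cong (_+ (- 1ℚ) * g i x) (ι-Cpred-pascal (x ℕ.+ n) (i ℕ.+ x)))
               (solve 2 (λ a b → (a :+ b) :+ (:- con 1ℚ) :* a := b) refl (g i x) (ι (Cpred (x ℕ.+ n) (suc (i ℕ.+ x))))))

Nar-form : ∀ m j → Nar (suc m) (suc j) ≡ ι (suc m C suc j) * (inv m * ι (Cpred (suc m) (suc j)))
Nar-form m j = begin
  ℤ.+ ((suc m C suc j) ℕ.* (suc m C j)) / suc m     ≡⟨ frac ((suc m C suc j) ℕ.* (suc m C j)) m ⟩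
  ι ((suc m C suc j) ℕ.* (suc m C j)) * inv m     ≡⟨ cong (_* inv m) (ι-* (suc m C suc j) (suc m C j)) ⟩
  ι (suc m C suc j) * ι (suc m C j) * inv m       ≡⟨ solve 3 (λ a b d → a :* b :* d := a :* (d :* b)) refl (ι (suc m C suc j)) (ι (suc m C j)) (inv m) ⟩
  ι (suc m C suc j) * (inv m * ι (suc m C j))     ∎

-- By absorption, w(n,j) = C(n,j)·(1/n)·C(j+n,j−1).
w-form : ∀ m j → w (suc m) (suc j) ≡ ι (suc m C suc j) * (inv m * ι (Cpred (suc j ℕ.+ suc m) (suc j)))
w-form m j = begin
  ℤ.+ ((m C j) ℕ.* T) / suc j                      ≡⟨ frac-cross ((m C j) ℕ.* T) ((suc m C suc j) ℕ.* T) j m cross ⟩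
  ℤ.+ ((suc m C suc j) ℕ.* T) / suc m              ≡⟨ frac ((suc m C suc j) ℕ.* T) m ⟩
  ι ((suc m C suc j) ℕ.* T) * inv m              ≡⟨ cong (_* inv m) (ι-* (suc m C suc j) T) ⟩
  ι (suc m C suc j) * ι T * inv m                ≡⟨ solve 3 (λ a b d → a :* b :* d := a :* (d :* b)) refl (ι (suc m C suc j)) (ι T) (inv m) ⟩
  ι (suc m C suc j) * (inv m * ι T)              ≡⟨ cong (λ t → ι (suc m C suc j) * (inv m * ι (t C j))) (ℕ.+-comm (suc m) (suc j)) ⟩
  ι (suc m C suc j) * (inv m * ι ((suc j ℕ.+ suc m) C j)) ∎
  where
  T : ℕ
  T = (suc m ℕ.+ suc j) C j
  rotate : ∀ a b c → a ℕ.* b ℕ.* c ≡ c ℕ.* a ℕ.* b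
  rotate = ℕ-Solver.solve-∀
  cross : (m C j) ℕ.* T ℕ.* suc m ≡ (suc m C suc j) ℕ.* T ℕ.* suc j
  cross = begin
    (m C j) ℕ.* T ℕ.* suc m          ≡⟨ rotate (m C j) T (suc m) ⟩
    suc m ℕ.* (m C j) ℕ.* T          ≡⟨ cong (ℕ._* T) (absorption m j) ⟨
    suc j ℕ.* (suc m C suc j) ℕ.* T  ≡⟨ rotate (suc m C suc j) T (suc j) ⟨
    (suc m C suc j) ℕ.* T ℕ.* suc j  ∎

-- The subset-of-subset identity turns the weights C(n−j,k−j)·C(n,j) into C(n,k)·C(k,j),
-- so both sums of the theorem collapse to C(n,k)·d·Σⱼ C(k,j)·Yⱼ.
collapse : ∀ {n k} (d : ℚ) (Y : ℕ → ℚ) → k ≤ n → Y 0 ≡ 0ℚ →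
  sum1 k (λ j → ι ((n ∸ j) C (k ∸ j)) * (ι (n C j) * (d * Y j)))
    ≡ ι (n C k) * (d * Σ₀ k (λ j → ι (k C j) * Y j))
collapse {n} {k} d Y k≤n Y0≡0 = begin
  sum1 k (λ j → ι ((n ∸ j) C (k ∸ j)) * (ι (n C j) * (d * Y j)))  ≡⟨ sum1-cong k (λ j _ j≤k → regroup j j≤k) ⟩
  sum1 k (λ j → (ι (n C k) * d) * (ι (k C j) * Y j))               ≡⟨ sum1-*ˡ k (ι (n C k) * d) _ ⟩
  (ι (n C k) * d) * sum1 k (λ j → ι (k C j) * Y j)                 ≡⟨ cong ((ι (n C k) * d) *_) (sum1≡Σ₀ k _ (trans (cong (ι 1 *_) Y0≡0) (*-zeroʳ (ι 1)))) ⟩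
  (ι (n C k) * d) * Σ₀ k (λ j → ι (k C j) * Y j)                   ≡⟨ solve 3 (λ a d s → (a :* d) :* s := a :* (d :* s)) refl (ι (n C k)) d _ ⟩
  ι (n C k) * (d * Σ₀ k (λ j → ι (k C j) * Y j))                   ∎
  where
  regroup : ∀ j → j ≤ k → ι ((n ∸ j) C (k ∸ j)) * (ι (n C j) * (d * Y j)) ≡ (ι (n C k) * d) * (ι (k C j) * Y j)
  regroup j j≤k = begin
    ι ((n ∸ j) C (k ∸ j)) * (ι (n C j) * (d * Y j))   ≡⟨ solve 4 (λ a b d y → a :* (b :* (d :* y)) := (a :* b) :* (d :* y)) refl (ι ((n ∸ j) C (k ∸ j))) (ι (n C j)) d (Y j) ⟩
    (ι ((n ∸ j) C (k ∸ j)) * ι (n C j)) * (d * Y j)   ≡⟨ cong (_* (d * Y j)) (ι-* ((n ∸ j) C (k ∸ j)) (n C j)) ⟨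
    ι (((n ∸ j) C (k ∸ j)) ℕ.* (n C j)) * (d * Y j)   ≡⟨ cong (λ t → ι t * (d * Y j)) (subset-of-subset j≤k k≤n) ⟩
    ι ((n C k) ℕ.* (k C j)) * (d * Y j)               ≡⟨ cong (_* (d * Y j)) (ι-* (n C k) (k C j)) ⟩
    (ι (n C k) * ι (k C j)) * (d * Y j)               ≡⟨ solve 4 (λ a b d y → (a :* b) :* (d :* y) := (a :* d) :* (b :* y)) refl (ι (n C k)) (ι (k C j)) d (Y j) ⟩
    (ι (n C k) * d) * (ι (k C j) * Y j)               ∎

w-expansion : ∀ m l → l ≤ m →
  w (suc m) (suc l) ≡ sum1 (suc l) (λ j → ι ((suc m ∸ j) C (suc l ∸ j)) * Nar (suc m) j)
w-expansion m l l≤m = sym (begin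
  sum1 k (λ j → ι ((n ∸ j) C (k ∸ j)) * Nar n j)                            ≡⟨ sum1-cong k term ⟩
  sum1 k (λ j → ι ((n ∸ j) C (k ∸ j)) * (ι (n C j) * (inv m * ι (Cpred n j))))  ≡⟨ collapse (inv m) (ι ∘ Cpred n) (s≤s l≤m) refl ⟩
  ι (n C k) * (inv m * Σ₀ k (λ j → ι (k C j) * ι (Cpred n j)))              ≡⟨ cong (λ t → ι (n C k) * (inv m * t)) (vandermonde n k) ⟩
  ι (n C k) * (inv m * ι (Cpred (k ℕ.+ n) k))                                ≡⟨ w-form m l ⟨
  w n k                                                                      ∎)
  where
  n k : ℕ
  n = suc m
  k = suc l
  term : ∀ j → 1 ≤ j → j ≤ k → ι ((n ∸ j) C (k ∸ j)) * Nar n j ≡ ι ((n ∸ j) C (k ∸ j)) * (ι (n C j) * (inv m * ι (Cpred n j)))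
  term (suc j) _ _ = cong (ι ((n ∸ suc j) C (k ∸ suc j)) *_) (Nar-form m j)

Nar-inversion : ∀ m l → l ≤ m →
  Nar (suc m) (suc l) ≡ sum1 (suc l) (λ j → ι ((suc m ∸ j) C (suc l ∸ j)) * sgn (suc l ∸ j) * w (suc m) j)
Nar-inversion m l l≤m = sym (begin
  sum1 k (λ j → ι ((n ∸ j) C (k ∸ j)) * sgn (k ∸ j) * w n j)      ≡⟨ sum1-cong k term ⟩
  sum1 k (λ j → ι ((n ∸ j) C (k ∸ j)) * (ι (n C j) * (inv m * Y j)))  ≡⟨ collapse (inv m) Y (s≤s l≤m) (*-zeroʳ (sgn k)) ⟩
  ι (n C k) * (inv m * Σ₀ k (λ j → ι (k C j) * Y j))              ≡⟨ cong (λ t → ι (n C k) * (inv m * t)) (alternating n k) ⟩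
  ι (n C k) * (inv m * ι (Cpred n k))                              ≡⟨ Nar-form m l ⟨
  Nar n k                                                          ∎)
  where
  n k : ℕ
  n = suc m
  k = suc l
  Y : ℕ → ℚ
  Y j = sgn (k ∸ j) * ι (Cpred (j ℕ.+ n) j)
  term : ∀ j → 1 ≤ j → j ≤ k → ι ((n ∸ j) C (k ∸ j)) * sgn (k ∸ j) * w n j ≡ ι ((n ∸ j) C (k ∸ j)) * (ι (n C j) * (inv m * Y j))
  term (suc j) _ _ = begin
    ι ((n ∸ suc j) C (k ∸ suc j)) * sgn (k ∸ suc j) * w n (suc j)
      ≡⟨ cong (ι ((n ∸ suc j) C (k ∸ suc j)) * sgn (k ∸ suc j) *_) (w-form m j) ⟩
    ι ((n ∸ suc j) C (k ∸ suc j)) * sgn (k ∸ suc j) * (ι (n C suc j) * (inv m * ι (Cpred (suc j ℕ.+ n) (suc j))))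
      ≡⟨ solve 5 (λ a s b d x → a :* s :* (b :* (d :* x)) := a :* (b :* (d :* (s :* x)))) refl
           (ι ((n ∸ suc j) C (k ∸ suc j))) (sgn (k ∸ suc j)) (ι (n C suc j)) (inv m) (ι (Cpred (suc j ℕ.+ n) (suc j))) ⟩
    ι ((n ∸ suc j) C (k ∸ suc j)) * (ι (n C suc j) * (inv m * Y (suc j)))
      ∎

lemma4p4 : (n k : ℕ) → 1 ≤ k → k ≤ n →
    (w n k ≡ sum1 k (λ j → ι ((n ∸ j) C (k ∸ j)) * Nar n j))
    × (Nar n k ≡ sum1 k (λ j → ι ((n ∸ j) C (k ∸ j)) * sgn (k ∸ j) * w n j))
lemma4p4 (suc m) (suc l) (s≤s z≤n) (s≤s l≤m) = w-expansion m l l≤m , Nar-inversion m l l≤m
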